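{- For all $b\in\mathbb{F}_p$, $k\in\mathbb{N}$ and $t\in T^*$, the patch $h_{b,0}$ does not appear in $\sigma^k(t)$.
   Context: Let $p$ be an odd prime and $\mathbb{F}_p$ the field with $p$ elements. A tile is a unit equilateral triangle of the standard triangular lattice, oriented upward or downward, whose corners are decorated with elements of $\mathbb{F}_p$. $\triangle(x,y,z)$ is the upward tile with bottom-left, bottom-right, top corners $x,y,z$; $\triangledown(x,y,z)$ the downward tile with top-right, top-left, bottom corners $x,y,z$; $T$ is the set of all such tiles, $T^*=T\setminus\{\triangle(0,0,0),\triangledown(0,0,0)\}$. The substitution $\sigma$ inflates a tile by factor $2$ and replaces it by four unit tiles: $\sigma(\triangle(x,y,z))$ consists of bottom-left $\triangle(x,x+y,x+z)$, bottom-right $\triangle(x+y,y,y+z)$, top $\triangle(x+z,y+z,z)$ and central $\triangledown(y+z,x+z,x+y)$; $\sigma(\triangledown(x,y,z))$ consists of top-right $\triangledown(x,x+y,x+z)$, top-left $\triangledown(x+y,y,y+z)$, bottom $\triangledown(x+z,y+z,z)$ and central $\triangle(y+z,x+z,x+y)$. $\sigma$ acts on patches tile by tile; $\sigma^k(t)$ is a triangle of side $2^k$ made of $4^k$ decorated unit tiles (corners of tiles meeting at a common point carry a common value). For $b,c\in\mathbb{F}_p$, $h_{b,c}$ denotes the hexagonal patch of the six unit tiles sharing a common vertex, decorated with $c$ at that common vertex and $b$ at each of the six other vertices; $h_{b,c}$ appears in $\sigma^k(t)$ if six tiles of $\sigma^k(t)$ form this decorated hexagon. -}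

module Defs where

open import Data.Nat using (ℕ; zero; suc; NonZero)
open import Data.Nat.DivMod using (_%_; m%n<n)
open import Data.Fin using (Fin; toℕ; fromℕ<)
open import Data.Integer using (ℤ; +_) renaming (_+_ to _+ℤ_; _*_ to _*ℤ_; _-_ to _-ℤ_)
open import Data.List using (List; []; _∷_; concatMap)
open import Data.List.Membership.Propositional using (_∈_)
open import Data.Product using (_×_; ∃₂)

𝔽 : ℕ → Set
𝔽 p = Fin p

_⊕_ : ∀ {p} → 𝔽 p → 𝔽 p → 𝔽 p
_⊕_ {suc n} x y = fromℕ< (m%n<n (toℕ x Data.Nat.+ toℕ y) (suc n))
  where import Data.Nat

𝟘 : ∀ {p} → .{{NonZero p}} → 𝔽 p
𝟘 {suc n} = Fin.zero
  where open import Data.Fin using (Fin)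

data Orientation : Set where
  up down : Orientation

-- Lattice points are  i·e₁ + j·e₂  (i j : ℤ) with e₁ = (1,0), e₂ = (1/2, √3/2).
-- An upward tile with anchor (i,j) has corners
--   bottom-left (i,j), bottom-right (i+1,j), top (i,j+1);
--   decoration △(x,y,z): x bottom-left, y bottom-right, z top.
-- A downward tile with anchor (i,j) has corners
--   top-left (i,j+1), top-right (i+1,j+1), bottom (i+1,j);
--   decoration ▽(x,y,z): x top-right, y top-left, z bottom.
record Tile (p : ℕ) : Set where
  constructor tile
  field
    orient : Orientation
    i j    : ℤ
    x y z  : 𝔽 p

Patch : ℕ → Set
Patch p = List (Tile p)

σ₁ : ∀ {p} → Tile p → Patch p
σ₁ (tile up i j x y z) =
    tile up   (two *ℤ i)        (two *ℤ j)        x         (x ⊕ y)   (x ⊕ z)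
  ∷ tile up   (two *ℤ i +ℤ one) (two *ℤ j)        (x ⊕ y)   y         (y ⊕ z)
  ∷ tile up   (two *ℤ i)        (two *ℤ j +ℤ one) (x ⊕ z)   (y ⊕ z)   z
  ∷ tile down (two *ℤ i)        (two *ℤ j)        (y ⊕ z)   (x ⊕ z)   (x ⊕ y)
  ∷ []
  where two one : ℤ
        two = + 2
        one = + 1
σ₁ (tile down i j x y z) =
    tile down (two *ℤ i +ℤ one) (two *ℤ j +ℤ one) x         (x ⊕ y)   (x ⊕ z)
  ∷ tile down (two *ℤ i)        (two *ℤ j +ℤ one) (x ⊕ y)   y         (y ⊕ z)
  ∷ tile down (two *ℤ i +ℤ one) (two *ℤ j)        (x ⊕ z)   (y ⊕ z)   z
  ∷ tile up   (two *ℤ i +ℤ one) (two *ℤ j +ℤ one) (y ⊕ z)   (x ⊕ z)   (x ⊕ y)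
  ∷ []
  where two one : ℤ
        two = + 2
        one = + 1

σ : ∀ {p} → Patch p → Patch p
σ = concatMap σ₁

σ^ : ∀ {p} → ℕ → Patch p → Patch p
σ^ zero    P = P
σ^ (suc k) P = σ (σ^ k P)

place : ∀ {p} → Orientation → 𝔽 p → 𝔽 p → 𝔽 p → Patch p
place o x y z = tile o (+ 0) (+ 0) x y z ∷ []

-- h_{b,c} appears in the patch P: there is a lattice point (a₁,a₂) such that
-- the six unit tiles sharing it belong to P, decorated with c at (a₁,a₂)
-- and b at the six other vertices.
Appears-h : ∀ {p} → 𝔽 p → 𝔽 p → Patch p → Set
Appears-h {p} b c P = ∃₂ λ (a₁ a₂ : ℤ) →
     tile up   a₁          a₂          c b b ∈ P   -- common vertex = bottom-left
   × tile up   (a₁ -ℤ one) a₂          b c b ∈ P   -- common vertex = bottom-right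
   × tile up   a₁          (a₂ -ℤ one) b b c ∈ P   -- common vertex = top
   × tile down a₁          (a₂ -ℤ one) b c b ∈ P   -- common vertex = top-left
   × tile down (a₁ -ℤ one) (a₂ -ℤ one) c b b ∈ P   -- common vertex = top-right
   × tile down (a₁ -ℤ one) a₂          b b c ∈ P   -- common vertex = bottom
  where one : ℤ
        one = + 1

-- Since σ never places two differently decorated tiles at the same position, the decoration of σᵏ(t) is a
-- function f of the vertices, and σ halves the lattice: the vertex 2v of σ(Q) carries f(v), and the midpoint of an
-- edge uw carries f(u) + f(w). Let h_{b,0} appear around a vertex v of σ(Q). If both coordinates of v are even,
-- the six tiles around v are corner children of the six tiles around v/2, which then form h_{b,0} in Q. Otherwise v
-- is the midpoint of an edge both of whose ends carry b, so b + b = 0 and b = 0 because p is odd. A single tile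
-- contains no hexagon, so descending to σ⁰(t) = t forces b = 0. But then the tile with corner v is zero, and a zero
-- tile only has zero ancestors (again because p is odd), so t itself would be zero.

module Submission where

open import Defs
open import Data.Bool using (Bool; true; false)
open import Data.Empty using (⊥-elim)
open import Data.Fin using (toℕ) renaming (zero to 0F)
open import Data.Fin.Properties using (toℕ-fromℕ<; toℕ-injective; toℕ<n)
open import Data.Integer using (ℤ; +_; ∣_∣) renaming (_+_ to _+ℤ_; _*_ to _*ℤ_; _-_ to _-ℤ_)
open import Data.Integer.DivMod using (_%ℕ_; _/ℕ_; n%ℕd<d; a≡a%ℕn+[a/ℕn]*n)
open import Data.Integer.Properties using (*-cancelˡ-≡; abs-*)
open import Data.Integer.Tactic.RingSolver using (solve-∀)
open import Data.List using (List; []; _∷_; [_]; map)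
open import Data.List.Membership.Propositional using (_∈_; find)
open import Data.List.Membership.Propositional.Properties using (∈-map⁻; ∈-concatMap⁻)
open import Data.List.Relation.Unary.Any using (here)
open import Data.Nat using (ℕ; NonZero; zero; suc; _+_; _*_; _∸_; _%_; s≤s)
open import Data.Nat.Coprimality using (Coprime; coprime-divisor)
open import Data.Nat.Divisibility using (_∣_; ∣1⇒≡1; %-presˡ-∣; m%n≡0⇒n∣m; n∣m⇒m%n≡0)
open import Data.Nat.DivMod using (%-distribˡ-+; m%n%n≡m%n; [m+n]%n≡m%n; m<n⇒m%n≡m)
open import Data.Nat.Primality using (Prime; prime⇒nonZero)
open import Data.Nat.Properties using (+-comm; +-assoc; +-identityʳ; m+[n∸m]≡n; <⇒≤; even≢odd)
open import Data.Product using (_×_; _,_; ∃; ∃₂)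
open import Data.Product.Properties using (×-≡,≡→≡; ×-≡,≡←≡)
open import Data.Sum using (_⊎_; inj₁; inj₂)
open import Relation.Nullary using (¬_)
open import Relation.Binary.PropositionalEquality
  using (_≡_; _≢_; refl; sym; trans; cong; cong₂; subst; subst₂; module ≡-Reasoning)

open ≡-Reasoning

module _ {A B C : Set} {a a' : A} {b b' : B} {c c' : C} where

  ≡,≡,≡←≡ : (a , b , c) ≡ (a' , b' , c') → a ≡ a' × b ≡ b' × c ≡ c'
  ≡,≡,≡←≡ refl = refl , refl , refl

  ≡,≡,≡→≡ : a ≡ a' → b ≡ b' → c ≡ c' → (a , b , c) ≡ (a' , b' , c')
  ≡,≡,≡→≡ refl refl refl = refl

[m%d+n]%d≡[m+n]%d : ∀ m n d .{{_ : NonZero d}} → (m % d + n) % d ≡ (m + n) % d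
[m%d+n]%d≡[m+n]%d m n d = begin
  (m % d + n) % d          ≡⟨ %-distribˡ-+ (m % d) n d ⟩
  (m % d % d + n % d) % d  ≡⟨ cong (λ u → (u + n % d) % d) (m%n%n≡m%n m d) ⟩
  (m % d + n % d) % d      ≡⟨ %-distribˡ-+ m n d ⟨
  (m + n) % d              ∎

odd⇒coprime-2 : ∀ {m} → m % 2 ≡ 1 → Coprime m 2
odd⇒coprime-2 odd {d} (d∣m , d∣2) = ∣1⇒≡1 (subst (d ∣_) odd (%-presˡ-∣ d∣m d∣2))

module _ {n : ℕ} where

  private
    M : ℕ
    M = suc n

  toℕ-⊕ : (x y : 𝔽 M) → toℕ (x ⊕ y) ≡ (toℕ x + toℕ y) % M
  toℕ-⊕ x y = toℕ-fromℕ< _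

  ⊕-comm : (x y : 𝔽 M) → x ⊕ y ≡ y ⊕ x
  ⊕-comm x y = toℕ-injective (begin
    toℕ (x ⊕ y)          ≡⟨ toℕ-⊕ x y ⟩
    (toℕ x + toℕ y) % M  ≡⟨ cong (_% M) (+-comm (toℕ x) (toℕ y)) ⟩
    (toℕ y + toℕ x) % M  ≡⟨ toℕ-⊕ y x ⟨
    toℕ (y ⊕ x)          ∎)

  ⊕-identityˡ : (x : 𝔽 M) → 0F ⊕ x ≡ x
  ⊕-identityˡ x = toℕ-injective (trans (toℕ-⊕ 0F x) (m<n⇒m%n≡m (toℕ<n x)))

  ⊕-identityʳ : (x : 𝔽 M) → x ⊕ 0F ≡ x
  ⊕-identityʳ x = trans (⊕-comm x 0F) (⊕-identityˡ x)

  ⊕-cancelʳ : (c : 𝔽 M) {a b : 𝔽 M} → a ⊕ c ≡ b ⊕ c → a ≡ b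
  ⊕-cancelʳ c {a} {b} eq = toℕ-injective (begin
    toℕ a                            ≡⟨ subtract-c a ⟨
    (toℕ (a ⊕ c) + (M ∸ toℕ c)) % M  ≡⟨ cong (λ u → (toℕ u + (M ∸ toℕ c)) % M) eq ⟩
    (toℕ (b ⊕ c) + (M ∸ toℕ c)) % M  ≡⟨ subtract-c b ⟩
    toℕ b                            ∎)
    where
    subtract-c : ∀ u → (toℕ (u ⊕ c) + (M ∸ toℕ c)) % M ≡ toℕ u
    subtract-c u = begin
      (toℕ (u ⊕ c) + (M ∸ toℕ c)) % M          ≡⟨ cong (λ v → (v + (M ∸ toℕ c)) % M) (toℕ-⊕ u c) ⟩
      ((toℕ u + toℕ c) % M + (M ∸ toℕ c)) % M  ≡⟨ [m%d+n]%d≡[m+n]%d (toℕ u + toℕ c) (M ∸ toℕ c) M ⟩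
      (toℕ u + toℕ c + (M ∸ toℕ c)) % M        ≡⟨ cong (_% M) (+-assoc (toℕ u) (toℕ c) (M ∸ toℕ c)) ⟩
      (toℕ u + (toℕ c + (M ∸ toℕ c))) % M      ≡⟨ cong (λ v → (toℕ u + v) % M) (m+[n∸m]≡n (<⇒≤ (toℕ<n c))) ⟩
      (toℕ u + M) % M                          ≡⟨ [m+n]%n≡m%n (toℕ u) M ⟩
      toℕ u % M                                ≡⟨ m<n⇒m%n≡m (toℕ<n u) ⟩
      toℕ u                                    ∎

  x≡0⇒x⊕y≡y : ∀ {x : 𝔽 M} y → x ≡ 0F → x ⊕ y ≡ y
  x≡0⇒x⊕y≡y y refl = ⊕-identityˡ y

  y≡0⇒x⊕y≡x : ∀ (x : 𝔽 M) {y} → y ≡ 0F → x ⊕ y ≡ x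
  y≡0⇒x⊕y≡x x refl = ⊕-identityʳ x

  x⊕x≡0⇒x≡0 : M % 2 ≡ 1 → (x : 𝔽 M) → x ⊕ x ≡ 0F → x ≡ 0F
  x⊕x≡0⇒x≡0 odd x eq = toℕ-injective (begin
    toℕ x      ≡⟨ m<n⇒m%n≡m (toℕ<n x) ⟨
    toℕ x % M  ≡⟨ n∣m⇒m%n≡0 (toℕ x) M (coprime-divisor (odd⇒coprime-2 odd) M∣2x) ⟩
    0          ∎)
    where
    M∣2x : M ∣ 2 * toℕ x
    M∣2x = m%n≡0⇒n∣m (2 * toℕ x) M (begin
      (2 * toℕ x) % M        ≡⟨ cong (λ v → (toℕ x + v) % M) (+-identityʳ (toℕ x)) ⟩
      (toℕ x + toℕ x) % M    ≡⟨ toℕ-⊕ x x ⟨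
      toℕ (x ⊕ x)            ≡⟨ cong toℕ eq ⟩
      0                      ∎)

dilate : Bool → ℤ → ℤ
dilate false i = + 2 *ℤ i
dilate true  i = + 2 *ℤ i +ℤ + 1

infixl 6 _-ᵇ_
_-ᵇ_ : ℤ → Bool → ℤ
a -ᵇ false = a
a -ᵇ true  = a -ℤ + 1

dilate-ᵇ : ∀ d i → dilate d i -ᵇ d ≡ dilate false i
dilate-ᵇ false i = refl
dilate-ᵇ true  i = lemma i
  where
  lemma : ∀ i → + 2 *ℤ i +ℤ + 1 -ℤ + 1 ≡ + 2 *ℤ i
  lemma = solve-∀

dilate-false-ᵇ : ∀ d i → dilate false i -ᵇ d ≡ dilate d (i -ᵇ d)
dilate-false-ᵇ false i = refl
dilate-false-ᵇ true  i = lemma i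
  where
  lemma : ∀ i → + 2 *ℤ i -ℤ + 1 ≡ + 2 *ℤ (i -ℤ + 1) +ℤ + 1
  lemma = solve-∀

even≢odd-ℤ : ∀ i j → dilate false i ≢ dilate true j
even≢odd-ℤ i j eq = even≢odd ∣ i -ℤ j ∣ 0 (begin
  2 * ∣ i -ℤ j ∣                 ≡⟨ abs-* (+ 2) (i -ℤ j) ⟨
  ∣ + 2 *ℤ (i -ℤ j) ∣            ≡⟨ cong ∣_∣ (distrib i j) ⟩
  ∣ + 2 *ℤ i -ℤ + 2 *ℤ j ∣       ≡⟨ cong (λ a → ∣ a -ℤ + 2 *ℤ j ∣) eq ⟩
  ∣ + 2 *ℤ j +ℤ + 1 -ℤ + 2 *ℤ j ∣ ≡⟨ cong ∣_∣ (cancel j) ⟩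
  1                              ∎)
  where
  distrib : ∀ i j → + 2 *ℤ (i -ℤ j) ≡ + 2 *ℤ i -ℤ + 2 *ℤ j
  distrib = solve-∀
  cancel : ∀ j → + 2 *ℤ j +ℤ + 1 -ℤ + 2 *ℤ j ≡ + 1
  cancel = solve-∀

dilate-injective : ∀ {d d' i i'} → dilate d i ≡ dilate d' i' → d ≡ d' × i ≡ i'
dilate-injective {false} {false} {i} {i'} eq = refl , *-cancelˡ-≡ (+ 2) i i' eq
dilate-injective {true}  {true}  {i} {i'} eq =
  refl , *-cancelˡ-≡ (+ 2) i i' (trans (sym (dilate-ᵇ true i)) (trans (cong (_-ᵇ true) eq) (dilate-ᵇ true i')))
dilate-injective {false} {true}  {i} {i'} eq = ⊥-elim (even≢odd-ℤ i i' eq)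
dilate-injective {true}  {false} {i} {i'} eq = ⊥-elim (even≢odd-ℤ i' i (sym eq))

dilate-surjective : ∀ a → ∃₂ λ d i → a ≡ dilate d i
dilate-surjective a with a %ℕ 2 | n%ℕd<d a 2 | a≡a%ℕn+[a/ℕn]*n a 2
... | 0 | _ | eq = false , a /ℕ 2 , trans eq (lemma (a /ℕ 2))
  where
  lemma : ∀ q → + 0 +ℤ q *ℤ + 2 ≡ + 2 *ℤ q
  lemma = solve-∀
... | 1 | _ | eq = true , a /ℕ 2 , trans eq (lemma (a /ℕ 2))
  where
  lemma : ∀ q → + 1 +ℤ q *ℤ + 2 ≡ + 2 *ℤ q +ℤ + 1
  lemma = solve-∀
... | suc (suc _) | s≤s (s≤s ()) | _

data Corner : Set where
  first second third : Corner

data Part : Set where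
  corner : Corner → Part
  centre : Part

parts : List Part
parts = corner first ∷ corner second ∷ corner third ∷ centre ∷ []

-- The offset of corner π from the anchor of a tile of orientation o; it is also the anchor parity of the
-- child of that tile at corner π.
cornerᵢ cornerⱼ : Orientation → Corner → Bool
cornerᵢ up   first  = false
cornerᵢ up   second = true
cornerᵢ up   third  = false
cornerᵢ down first  = true
cornerᵢ down second = false
cornerᵢ down third  = true
cornerⱼ up   first  = false
cornerⱼ up   second = false
cornerⱼ up   third  = true
cornerⱼ down first  = true
cornerⱼ down second = true
cornerⱼ down third  = false

partᵢ partⱼ : Orientation → Part → Bool
partᵢ o    (corner π) = cornerᵢ o π
partᵢ up   centre     = false
partᵢ down centre     = true
partⱼ o    (corner π) = cornerⱼ o π
partⱼ up   centre     = false
partⱼ down centre     = true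

flip : Orientation → Orientation
flip up   = down
flip down = up

childOrientation : Orientation → Part → Orientation
childOrientation o (corner _) = o
childOrientation o centre     = flip o

Placement : Set
Placement = Orientation × Bool × Bool

placement : Orientation → Part → Placement
placement o π = childOrientation o π , partᵢ o π , partⱼ o π

unplace : Placement → Orientation × Part
unplace (up   , false , false) = up   , corner first
unplace (up   , true  , false) = up   , corner second
unplace (up   , false , true)  = up   , corner third
unplace (up   , true  , true)  = down , centre
unplace (down , true  , true)  = down , corner first
unplace (down , false , true)  = down , corner second
unplace (down , true  , false) = down , corner third
unplace (down , false , false) = up   , centre

unplace-placement : ∀ o π → unplace (placement o π) ≡ (o , π)
unplace-placement up   (corner first)  = refl
unplace-placement up   (corner second) = refl
unplace-placement up   (corner third)  = refl
unplace-placement up   centre          = refl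
unplace-placement down (corner first)  = refl
unplace-placement down (corner second) = refl
unplace-placement down (corner third)  = refl
unplace-placement down centre          = refl

placement-injective : ∀ {o π o' π'} → placement o π ≡ placement o' π' → o ≡ o' × π ≡ π'
placement-injective {o} {π} {o'} {π'} eq = ×-≡,≡←≡ (begin
  (o , π)                  ≡⟨ unplace-placement o π ⟨
  unplace (placement o π)  ≡⟨ cong unplace eq ⟩
  unplace (placement o' π') ≡⟨ unplace-placement o' π' ⟩
  (o' , π')                ∎)

Decoration : ℕ → Set
Decoration p = 𝔽 p × 𝔽 p × 𝔽 p

module _ {p : ℕ} where

  decorated : Orientation → ℤ → ℤ → Decoration p → Tile p
  decorated o i j (x , y , z) = tile o i j x y z

  decoration : Tile p → Decoration p
  decoration t = Tile.x t , Tile.y t , Tile.z t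

  childDecoration : Part → Decoration p → Decoration p
  childDecoration (corner first)  (x , y , z) = x , x ⊕ y , x ⊕ z
  childDecoration (corner second) (x , y , z) = x ⊕ y , y , y ⊕ z
  childDecoration (corner third)  (x , y , z) = x ⊕ z , y ⊕ z , z
  childDecoration centre          (x , y , z) = y ⊕ z , x ⊕ z , x ⊕ y

  child : Part → Tile p → Tile p
  child π (tile o i j x y z) =
    decorated (childOrientation o π) (dilate (partᵢ o π) i) (dilate (partⱼ o π) j) (childDecoration π (x , y , z))

  σ₁-children : ∀ t → σ₁ t ≡ map (λ π → child π t) parts
  σ₁-children (tile up   i j x y z) = refl
  σ₁-children (tile down i j x y z) = refl

  ∈-σ⁻ : ∀ {c Q} → c ∈ σ Q → ∃₂ λ t π → t ∈ Q × c ≡ child π t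
  ∈-σ⁻ {c} {Q} c∈σQ with find (∈-concatMap⁻ σ₁ {xs = Q} c∈σQ)
  ... | t , t∈Q , c∈σ₁t with ∈-map⁻ (λ π → child π t) {xs = parts} (subst (c ∈_) (σ₁-children t) c∈σ₁t)
  ...   | π , _ , c≡ = t , π , t∈Q , c≡

  parent-at : ∀ {Q o π I J d} →
    decorated (childOrientation o π) (dilate (partᵢ o π) I) (dilate (partⱼ o π) J) d ∈ σ Q →
    ∃ λ e → decorated o I J e ∈ Q × d ≡ childDecoration π e
  parent-at {o = o} {π} {I} {J} c∈σQ with ∈-σ⁻ c∈σQ
  ... | tile o' i j x y z , π' , t∈Q , eq
    with dilate-injective {partᵢ o π} {partᵢ o' π'} {I} (cong Tile.i eq)
       | dilate-injective {partⱼ o π} {partⱼ o' π'} {J} (cong Tile.j eq)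
  ... | dᵢ≡ , refl | dⱼ≡ , refl
    with placement-injective {o} {π} {o'} {π'} (×-≡,≡→≡ (cong Tile.orient eq , ×-≡,≡→≡ (dᵢ≡ , dⱼ≡)))
  ... | refl , refl = (x , y , z) , t∈Q , cong decoration eq

  Functional : Patch p → Set
  Functional Q = ∀ {o i j d d'} → decorated o i j d ∈ Q → decorated o i j d' ∈ Q → d ≡ d'

  singleton-Functional : ∀ t → Functional [ t ]
  singleton-Functional t (here eq) (here eq') = trans (cong decoration eq) (sym (cong decoration eq'))

  σ-siblings : ∀ {Q o I J π π' d d'} → Functional Q →
    decorated (childOrientation o π) (dilate (partᵢ o π) I) (dilate (partⱼ o π) J) d ∈ σ Q →
    decorated (childOrientation o π') (dilate (partᵢ o π') I) (dilate (partⱼ o π') J) d' ∈ σ Q →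
    ∃ λ e → d ≡ childDecoration π e × d' ≡ childDecoration π' e
  σ-siblings {Q} {o} {I} {J} {π} {π'} fQ c∈σQ c'∈σQ
    with parent-at {Q} {o} {π} {I} {J} c∈σQ | parent-at {Q} {o} {π'} {I} {J} c'∈σQ
  ... | e , e∈Q , d≡ | e' , e'∈Q , d'≡ = e , d≡ , trans d'≡ (cong (childDecoration π') (fQ e'∈Q e∈Q))

  σ-preserves-Functional : ∀ {Q} → Functional Q → Functional (σ Q)
  σ-preserves-Functional {Q} fQ {d' = d'} c∈σQ c'∈σQ with ∈-σ⁻ {Q = Q} c∈σQ
  ... | tile o I J x y z , π , _ , eq
    with σ-siblings {Q} {o} {I} {J} {π} {π} fQ (subst (_∈ σ Q) eq c∈σQ)
           (subst (λ c → decorated (Tile.orient c) (Tile.i c) (Tile.j c) d' ∈ σ Q) eq c'∈σQ)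
  ... | e , d≡ , d'≡ = trans (cong decoration eq) (trans d≡ (sym d'≡))

  σ^-preserves-Functional : ∀ {Q} k → Functional Q → Functional (σ^ k Q)
  σ^-preserves-Functional zero    fQ = fQ
  σ^-preserves-Functional (suc k) fQ = σ-preserves-Functional (σ^-preserves-Functional k fQ)

  cornerDecoration : Corner → 𝔽 p → 𝔽 p → Decoration p
  cornerDecoration first  c b = c , b , b
  cornerDecoration second c b = b , c , b
  cornerDecoration third  c b = b , b , c

  -- The six tiles around the vertex (v₁ , v₂), which is corner π of the tile of orientation o.
  hexagonTile : 𝔽 p → 𝔽 p → ℤ → ℤ → Orientation → Corner → Tile p
  hexagonTile b c v₁ v₂ o π = decorated o (v₁ -ᵇ cornerᵢ o π) (v₂ -ᵇ cornerⱼ o π) (cornerDecoration π c b)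

  Hexagon : 𝔽 p → 𝔽 p → Patch p → ℤ → ℤ → Set
  Hexagon b c Q v₁ v₂ = ∀ o π → hexagonTile b c v₁ v₂ o π ∈ Q

  Appears-h⇒Hexagon : ∀ {b c Q} → Appears-h b c Q → ∃₂ λ v₁ v₂ → Hexagon b c Q v₁ v₂
  Appears-h⇒Hexagon (v₁ , v₂ , m₁ , m₂ , m₃ , m₄ , m₅ , m₆) = v₁ , v₂ , λ where
    up   first  → m₁
    up   second → m₂
    up   third  → m₃
    down second → m₄
    down first  → m₅
    down third  → m₆

  singleton-¬Hexagon : ∀ t {b c v₁ v₂} → ¬ Hexagon b c [ t ] v₁ v₂
  singleton-¬Hexagon t hex with hex up first | hex down first
  ... | here eq | here eq' with trans (cong Tile.orient eq) (sym (cong Tile.orient eq'))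
  ... | ()

module _ {n : ℕ} where

  cornerChild-zero⁻ : ∀ π {b : 𝔽 (suc n)} e →
    childDecoration (corner π) e ≡ cornerDecoration π 0F b → e ≡ cornerDecoration π 0F b
  cornerChild-zero⁻ first (x , y , z) eq with ≡,≡,≡←≡ eq
  ... | x≡0 , x⊕y≡b , x⊕z≡b =
    ≡,≡,≡→≡ x≡0 (trans (sym (x≡0⇒x⊕y≡y y x≡0)) x⊕y≡b) (trans (sym (x≡0⇒x⊕y≡y z x≡0)) x⊕z≡b)
  cornerChild-zero⁻ second (x , y , z) eq with ≡,≡,≡←≡ eq
  ... | x⊕y≡b , y≡0 , y⊕z≡b =
    ≡,≡,≡→≡ (trans (sym (y≡0⇒x⊕y≡x x y≡0)) x⊕y≡b) y≡0 (trans (sym (x≡0⇒x⊕y≡y z y≡0)) y⊕z≡b)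
  cornerChild-zero⁻ third (x , y , z) eq with ≡,≡,≡←≡ eq
  ... | x⊕z≡b , y⊕z≡b , z≡0 =
    ≡,≡,≡→≡ (trans (sym (y≡0⇒x⊕y≡x x z≡0)) x⊕z≡b) (trans (sym (y≡0⇒x⊕y≡x y z≡0)) y⊕z≡b) z≡0

  zeros : Decoration (suc n)
  zeros = 0F , 0F , 0F

  HasZeroTile : Patch (suc n) → Set
  HasZeroTile Q = ∃ λ t → t ∈ Q × decoration t ≡ zeros

  singleton-HasZeroTile⁻ : ∀ t → HasZeroTile [ t ] → decoration t ≡ zeros
  singleton-HasZeroTile⁻ t (_ , here refl , t≡zeros) = t≡zeros

  σ-Hexagon-evenEven⁻ : ∀ {Q : Patch (suc n)} {b w₁ w₂} →
    Hexagon b 0F (σ Q) (dilate false w₁) (dilate false w₂) → Hexagon b 0F Q w₁ w₂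
  σ-Hexagon-evenEven⁻ {Q} {b} {w₁} {w₂} hex o π
    with parent-at {Q = Q} {o} {corner π} {w₁ -ᵇ cornerᵢ o π} {w₂ -ᵇ cornerⱼ o π}
           (subst₂ (λ a a' → decorated o a a' (cornerDecoration π 0F b) ∈ σ Q)
                   (dilate-false-ᵇ (cornerᵢ o π) w₁) (dilate-false-ᵇ (cornerⱼ o π) w₂) (hex o π))
  ... | e , e∈Q , eq = subst (λ e → decorated o _ _ e ∈ Q) (cornerChild-zero⁻ π e (sym eq)) e∈Q

  -- (2I+1, 2J), (2I, 2J+1) and (2I+1, 2J+1) are the midpoints of the edges of the up tile at (I, J); each
  -- proof reads the values at both ends of the edge off the two corner children meeting there.
  σ-Hexagon-oddEven⇒b⊕b≡0 : ∀ {Q : Patch (suc n)} {b I J} → Functional Q →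
    Hexagon b 0F (σ Q) (dilate true I) (dilate false J) → b ⊕ b ≡ 0F
  σ-Hexagon-oddEven⇒b⊕b≡0 {Q} {b} {I} {J} fQ hex =
    let (x , y , z) , eq , eq' =
          σ-siblings {Q = Q} {up} {I} {J} {corner second} {corner first} fQ (hex up first)
            (subst (λ a → decorated up a (dilate false J) (cornerDecoration second 0F b) ∈ σ Q)
                   (dilate-ᵇ true I) (hex up second))
        0≡x⊕y , b≡y , _ = ≡,≡,≡←≡ eq
        b≡x   , _   , _ = ≡,≡,≡←≡ eq'
    in trans (cong₂ _⊕_ b≡x b≡y) (sym 0≡x⊕y)

  σ-Hexagon-evenOdd⇒b⊕b≡0 : ∀ {Q : Patch (suc n)} {b I J} → Functional Q →
    Hexagon b 0F (σ Q) (dilate false I) (dilate true J) → b ⊕ b ≡ 0F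
  σ-Hexagon-evenOdd⇒b⊕b≡0 {Q} {b} {I} {J} fQ hex =
    let (x , _ , z) , eq , eq' =
          σ-siblings {Q = Q} {up} {I} {J} {corner third} {corner first} fQ (hex up first)
            (subst (λ a → decorated up (dilate false I) a (cornerDecoration third 0F b) ∈ σ Q)
                   (dilate-ᵇ true J) (hex up third))
        0≡x⊕z , _ , b≡z = ≡,≡,≡←≡ eq
        b≡x   , _ , _   = ≡,≡,≡←≡ eq'
    in trans (cong₂ _⊕_ b≡x b≡z) (sym 0≡x⊕z)

  σ-Hexagon-oddOdd⇒b⊕b≡0 : ∀ {Q : Patch (suc n)} {b I J} → Functional Q →
    Hexagon b 0F (σ Q) (dilate true I) (dilate true J) → b ⊕ b ≡ 0F
  σ-Hexagon-oddOdd⇒b⊕b≡0 {Q} {b} {I} {J} fQ hex =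
    let (_ , y , z) , eq , eq' =
          σ-siblings {Q = Q} {up} {I} {J} {corner second} {corner third} fQ
            (subst (λ a → decorated up (dilate true I) a (cornerDecoration third 0F b) ∈ σ Q)
                   (dilate-ᵇ true J) (hex up third))
            (subst (λ a → decorated up a (dilate true J) (cornerDecoration second 0F b) ∈ σ Q)
                   (dilate-ᵇ true I) (hex up second))
        _ , b≡y , 0≡y⊕z = ≡,≡,≡←≡ eq
        _ , _   , b≡z   = ≡,≡,≡←≡ eq'
    in trans (cong₂ _⊕_ b≡y b≡z) (sym 0≡y⊕z)

  module _ (odd : suc n % 2 ≡ 1) where

    childDecoration-zeros⁻ : ∀ π (e : Decoration (suc n)) → childDecoration π e ≡ zeros → e ≡ zeros
    childDecoration-zeros⁻ (corner first)  e = cornerChild-zero⁻ first e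
    childDecoration-zeros⁻ (corner second) e = cornerChild-zero⁻ second e
    childDecoration-zeros⁻ (corner third)  e = cornerChild-zero⁻ third e
    childDecoration-zeros⁻ centre (x , y , z) eq with ≡,≡,≡←≡ eq
    ... | y⊕z≡0 , x⊕z≡0 , x⊕y≡0 = ≡,≡,≡→≡ x≡0 y≡0 (trans (sym (x≡0⇒x⊕y≡y z y≡0)) y⊕z≡0)
      where
      y≡x : y ≡ x
      y≡x = ⊕-cancelʳ z (trans y⊕z≡0 (sym x⊕z≡0))
      x≡0 : x ≡ 0F
      x≡0 = x⊕x≡0⇒x≡0 odd x (trans (cong (x ⊕_) (sym y≡x)) x⊕y≡0)
      y≡0 : y ≡ 0F
      y≡0 = trans y≡x x≡0

    σ-HasZeroTile⁻ : ∀ {Q : Patch (suc n)} → HasZeroTile (σ Q) → HasZeroTile Q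
    σ-HasZeroTile⁻ {Q} (c , c∈σQ , c≡0) with ∈-σ⁻ {Q = Q} c∈σQ
    ... | t , π , t∈Q , refl = t , t∈Q , childDecoration-zeros⁻ π (decoration t) c≡0

    σ^-HasZeroTile⁻ : ∀ {Q : Patch (suc n)} k → HasZeroTile (σ^ k Q) → HasZeroTile Q
    σ^-HasZeroTile⁻ zero    z = z
    σ^-HasZeroTile⁻ (suc k) z = σ^-HasZeroTile⁻ k (σ-HasZeroTile⁻ z)

    σ-Hexagon⁻ : ∀ {Q : Patch (suc n)} {b v₁ v₂} → Functional Q → Hexagon b 0F (σ Q) v₁ v₂ →
      (∃₂ λ w₁ w₂ → Hexagon b 0F Q w₁ w₂) ⊎ b ≡ 0F
    σ-Hexagon⁻ {b = b} {v₁} {v₂} fQ hex with dilate-surjective v₁ | dilate-surjective v₂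
    ... | false , I , refl | false , J , refl = inj₁ (I , J , σ-Hexagon-evenEven⁻ {w₁ = I} {J} hex)
    ... | true  , I , refl | false , J , refl = inj₂ (x⊕x≡0⇒x≡0 odd b (σ-Hexagon-oddEven⇒b⊕b≡0 {I = I} {J} fQ hex))
    ... | false , I , refl | true  , J , refl = inj₂ (x⊕x≡0⇒x≡0 odd b (σ-Hexagon-evenOdd⇒b⊕b≡0 {I = I} {J} fQ hex))
    ... | true  , I , refl | true  , J , refl = inj₂ (x⊕x≡0⇒x≡0 odd b (σ-Hexagon-oddOdd⇒b⊕b≡0 {I = I} {J} fQ hex))

    σ^-Hexagon⇒≡0 : ∀ {Q : Patch (suc n)} {b v₁ v₂} → Functional Q →
      (∀ {b' w₁ w₂} → ¬ Hexagon b' 0F Q w₁ w₂) → ∀ k → Hexagon b 0F (σ^ k Q) v₁ v₂ → b ≡ 0F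
    σ^-Hexagon⇒≡0 fQ noHexagon zero    hex = ⊥-elim (noHexagon hex)
    σ^-Hexagon⇒≡0 fQ noHexagon (suc k) hex with σ-Hexagon⁻ (σ^-preserves-Functional k fQ) hex
    ... | inj₁ (_ , _ , hex′) = σ^-Hexagon⇒≡0 fQ noHexagon k hex′
    ... | inj₂ b≡0            = b≡0

mainTheorem10 : (p : ℕ) (pr : Prime p) → p % 2 ≡ 1 →
    (b : 𝔽 p) (k : ℕ) (o : Orientation) (x y z : 𝔽 p) →
    ¬ (x ≡ 𝟘 {{prime⇒nonZero pr}} × y ≡ 𝟘 {{prime⇒nonZero pr}} × z ≡ 𝟘 {{prime⇒nonZero pr}}) →
    ¬ Appears-h b (𝟘 {{prime⇒nonZero pr}}) (σ^ k (place o x y z))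
mainTheorem10 zero    _ ()
mainTheorem10 (suc n) _ odd b k o x y z nonzero appears with Appears-h⇒Hexagon appears
... | v₁ , v₂ , hex = nonzero (≡,≡,≡←≡ (singleton-HasZeroTile⁻ t (σ^-HasZeroTile⁻ odd k zeroTile)))
  where
  t : Tile (suc n)
  t = tile o (+ 0) (+ 0) x y z
  b≡0 : b ≡ 0F
  b≡0 = σ^-Hexagon⇒≡0 odd (singleton-Functional t) (singleton-¬Hexagon t) k hex
  zeroTile : HasZeroTile (σ^ k [ t ])
  zeroTile = _ , hex up first , ≡,≡,≡→≡ refl b≡0 b≡0
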